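{- Let $V$ be a finite-dimensional $\mathbb{Q}$-vector space, $F=1+D$ an automorphism of $V$ with $V[D^2]=V[D]$, and $(\cdot,\cdot):V\times V\to\mathbb{Q}$ an $F$-invariant non-degenerate symmetric pairing. If $\Lambda\subset V$ is an $F$-stable full-rank lattice with $\Lambda^\vee\subseteq\Lambda$, then $$\mathfrak{B}_{\Lambda,\Lambda^\vee}=\frac{\Lambda+D^{ -1}\Lambda^\vee}{\Lambda+V[D]}\cong\frac{\Lambda^\vee\cap DV}{\Lambda^\vee\cap D\Lambda},$$ and both groups have trivial induced $F$-action.
   Context: $V[D]=\ker D$; $\Lambda^\vee=\{v\in V:(v,\lambda)\in\mathbb{Z}\ \forall\lambda\in\Lambda\}$; $D^{ -1}\Lambda^\vee=\{v\in V:Dv\in\Lambda^\vee\}$. -}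

module Defs where

open import Data.Nat using (ℕ; zero; suc)
open import Data.Fin using (Fin; zero; suc)
open import Data.Integer using (ℤ)
open import Data.Rational using (ℚ; _+_; _*_; _-_; 0ℚ; 1ℚ; _/_)
open import Data.Product using (Σ; ∃; _×_; _,_; proj₁)
open import Relation.Binary.PropositionalEquality using (_≡_)
open import Data.Unit using (⊤)

-- The ℚ-vector space V ≅ ℚⁿ (after choosing a basis).
Vect : ℕ → Set
Vect n = Fin n → ℚ

_≈_ : ∀ {n} → Vect n → Vect n → Set
v ≈ w = ∀ i → v i ≡ w i

0v : ∀ {n} → Vect n
0v _ = 0ℚ

_⊕_ : ∀ {n} → Vect n → Vect n → Vect n
(v ⊕ w) i = v i + w i

_⊖_ : ∀ {n} → Vect n → Vect n → Vect n
(v ⊖ w) i = v i - w i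

∑ : ∀ {n} → (Fin n → ℚ) → ℚ
∑ {zero} f = 0ℚ
∑ {suc n} f = f zero + ∑ (λ i → f (suc i))

Mat : ℕ → Set
Mat n = Fin n → Fin n → ℚ

apply : ∀ {n} → Mat n → Vect n → Vect n
apply M v i = ∑ (λ j → M i j * v j)

idMat : ∀ {n} → Mat n
idMat zero    zero    = 1ℚ
idMat zero    (suc j) = 0ℚ
idMat (suc i) zero    = 0ℚ
idMat (suc i) (suc j) = idMat i j

_+M_ : ∀ {n} → Mat n → Mat n → Mat n
(A +M B) i j = A i j + B i j

_∘M_ : ∀ {n} → Mat n → Mat n → Mat n
(A ∘M B) i j = ∑ (λ k → A i k * B k j)

IsAutomorphism : ∀ {n} → Mat n → Set
IsAutomorphism {n} F =
  Σ (Mat n) λ G → (∀ v → apply F (apply G v) ≈ v) × (∀ v → apply G (apply F v) ≈ v)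

pair : ∀ {n} → Mat n → Vect n → Vect n → ℚ
pair B v w = ∑ (λ i → ∑ (λ j → v i * B i j * w j))

ℤ→ℚ : ℤ → ℚ
ℤ→ℚ k = k / 1

Subset : ℕ → Set₁
Subset n = Vect n → Set

_⊆_ : ∀ {n} → Subset n → Subset n → Set
A ⊆ B = ∀ v → A v → B v

_+S_ : ∀ {n} → Subset n → Subset n → Subset n
(A +S B) v = ∃ λ a → ∃ λ b → A a × B b × v ≈ (a ⊕ b)

_∩S_ : ∀ {n} → Subset n → Subset n → Subset n
(A ∩S B) v = A v × B v

ker : ∀ {n} → Mat n → Subset n
ker D v = apply D v ≈ 0v

-- D A = image of A under D (DV for A = V)
img : ∀ {n} → Mat n → Subset n → Subset n
img D A v = ∃ λ w → A w × v ≈ apply D w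

whole : ∀ {n} → Subset n
whole _ = ⊤

preimg : ∀ {n} → Mat n → Subset n → Subset n
preimg D A v = A (apply D v)

-- Full-rank lattice: ℤ-span of a ℚ-basis of V (columns of an invertible matrix L)
latticeOf : ∀ {n} → Mat n → Subset n
latticeOf {n} L v = ∃ λ (z : Fin n → ℤ) → v ≈ apply L (λ j → ℤ→ℚ (z j))

dual : ∀ {n} → Mat n → Subset n → Subset n
dual B Λ v = ∀ l → Λ l → ∃ λ (k : ℤ) → pair B v l ≡ ℤ→ℚ k

-- Elements of the quotient A / C  (C ⊆ A), as elements of A modulo C
Elem : ∀ {n} → Subset n → Set
Elem {n} A = Σ (Vect n) A

-- Group isomorphism A/C ≅ A'/C' (quotients presented as setoids)
record QuotIso {n} (A C A' C' : Subset n) : Set where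
  field
    f           : Elem A → Elem A'
    well-def    : ∀ x y → C (proj₁ x ⊖ proj₁ y) → C' (proj₁ (f x) ⊖ proj₁ (f y))
    additive    : ∀ x y z → proj₁ z ≈ (proj₁ x ⊕ proj₁ y) →
                  C' (proj₁ (f z) ⊖ (proj₁ (f x) ⊕ proj₁ (f y)))
    injective   : ∀ x y → C' (proj₁ (f x) ⊖ proj₁ (f y)) → C (proj₁ x ⊖ proj₁ y)
    surjective  : ∀ (y : Elem A') → ∃ λ (x : Elem A) → C' (proj₁ (f x) ⊖ proj₁ y)

TrivialAction : ∀ {n} → Mat n → Subset n → Subset n → Set
TrivialAction F A C = ∀ v → A v → C (apply F v ⊖ v)

module Submission where

-- Writing x = a + b with a ∈ Λ and Db ∈ Λ^∨, the class of x is sent to Db; that this is a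
-- well-defined isomorphism is linear algebra, valid for any two subgroups in place of Λ, Λ^∨.
-- F = 1 + D acts on both quotients by adding Dx, which lies in Λ on the left (Da = Fa − a and
-- Db ∈ Λ^∨ ⊆ Λ) and in Λ^∨ ∩ DΛ on the right as soon as FΛ^∨ ⊆ Λ^∨. For that inclusion: F is an
-- isometry, so it is injective on Λ/Λ^∨, which is finite because NΛ ⊆ Λ^∨ for a common
-- denominator N of the Gram matrix of Λ; hence F is onto Λ/Λ^∨. Given v ∈ Λ^∨ and l ∈ Λ, pick
-- m ∈ Λ with Fm ≡ l modulo Λ^∨; then (Fv, l) ≡ (Fv, Fm) = (v, m) ≡ 0 modulo ℤ.

open import Defs
open import Level using (0ℓ)
open import Data.Nat as ℕ using (ℕ; zero; suc; NonZero)
import Data.Nat.Properties as NP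
open import Data.Nat.GeneralisedArithmetic using (fold; fold-+)
open import Data.Fin using (Fin; zero; suc; toℕ; combine; remQuot)
open import Data.Fin.Properties using (pigeonhole; remQuot-combine)
open import Data.Integer as ℤ using (ℤ)
import Data.Integer.Properties as ZP
open import Data.Integer.DivMod using (_/ℕ_; _%ℕ_; a≡a%ℕn+[a/ℕn]*n; n%ℕd<d)
open import Data.Rational using (ℚ; mkℚ; _+_; _*_; _-_; -_; 0ℚ; 1ℚ)
import Data.Rational.Properties as QP
import Data.Rational.Unnormalised as U
import Data.Rational.Unnormalised.Properties as UP
open import Data.Rational.Literals using (fromℤ)
open import Data.Product using (∃; _×_; _,_; proj₁; uncurry)
open import Data.Vec using (Vec; []; _∷_; lookup; tabulate)
open import Data.Vec.Properties using (lookup∘tabulate)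
open import Data.List using (List; []; _∷_; map; upTo; length; cartesianProductWith)
open import Data.List.Relation.Unary.Any as Any using (here)
open import Data.List.Relation.Unary.Any.Properties using (lookup-index; map⁺)
open import Data.List.Membership.Propositional using (_∈_)
open import Data.List.Membership.Propositional.Properties using (∈-upTo⁺; ∈-cartesianProductWith⁺)
open import Relation.Binary.Bundles using (Setoid)
import Data.List.Relation.Unary.Enumerates.Setoid as Enumerates
open import Relation.Binary.PropositionalEquality
open import Tactic.RingSolver using (solve-∀)
open import Tactic.RingSolver.Core.AlmostCommutativeRing using (AlmostCommutativeRing; fromCommutativeRing)
open import Data.Maybe using (just; nothing)
import Algebra.Properties.Semiring.Sum as SemiringSum
open import Algebra.Bundles using (CommutativeRing)
open ≡-Reasoning

-- Recognising 0ℚ lets the reflective solver cancel terms such as x - x.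
ℚ-ring : AlmostCommutativeRing 0ℓ 0ℓ
ℚ-ring = fromCommutativeRing QP.+-*-commutativeRing λ where
  (mkℚ (ℤ.+ 0) 0 _) → just refl
  _                 → nothing

IsInt : ℚ → Set
IsInt q = ∃ λ (k : ℤ) → q ≡ ℤ→ℚ k

ℤ→ℚ≡fromℤ : ∀ k → ℤ→ℚ k ≡ fromℤ k
ℤ→ℚ≡fromℤ k = QP.↥p/↧p≡p (fromℤ k)

ℤ→ℚ-+ : ∀ a b → ℤ→ℚ (a ℤ.+ b) ≡ ℤ→ℚ a + ℤ→ℚ b
ℤ→ℚ-+ a b = begin
  ℤ→ℚ (a ℤ.+ b)      ≡⟨ ℤ→ℚ≡fromℤ (a ℤ.+ b) ⟩
  fromℤ (a ℤ.+ b)    ≡⟨ QP.toℚᵘ-injective (UP.≃-sym (UP.≃-trans (QP.toℚᵘ-homo-+ (fromℤ a) (fromℤ b)) (U.*≡* eq))) ⟩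
  fromℤ a + fromℤ b  ≡⟨ sym (cong₂ _+_ (ℤ→ℚ≡fromℤ a) (ℤ→ℚ≡fromℤ b)) ⟩
  ℤ→ℚ a + ℤ→ℚ b      ∎
  where
  eq : (a ℤ.* ℤ.+ 1 ℤ.+ b ℤ.* ℤ.+ 1) ℤ.* ℤ.+ 1 ≡ (a ℤ.+ b) ℤ.* ℤ.+ 1
  eq = trans (ZP.*-identityʳ _) (trans (cong₂ ℤ._+_ (ZP.*-identityʳ a) (ZP.*-identityʳ b)) (sym (ZP.*-identityʳ _)))

ℤ→ℚ-* : ∀ a b → ℤ→ℚ (a ℤ.* b) ≡ ℤ→ℚ a * ℤ→ℚ b
ℤ→ℚ-* a b = begin
  ℤ→ℚ (a ℤ.* b)      ≡⟨ ℤ→ℚ≡fromℤ (a ℤ.* b) ⟩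
  fromℤ (a ℤ.* b)    ≡⟨ QP.toℚᵘ-injective (UP.≃-sym (UP.≃-trans (QP.toℚᵘ-homo-* (fromℤ a) (fromℤ b)) (U.*≡* refl))) ⟩
  fromℤ a * fromℤ b  ≡⟨ sym (cong₂ _*_ (ℤ→ℚ≡fromℤ a) (ℤ→ℚ≡fromℤ b)) ⟩
  ℤ→ℚ a * ℤ→ℚ b      ∎

ℤ→ℚ-neg : ∀ a → ℤ→ℚ (ℤ.- a) ≡ - ℤ→ℚ a
ℤ→ℚ-neg a = begin
  ℤ→ℚ (ℤ.- a)    ≡⟨ ℤ→ℚ≡fromℤ (ℤ.- a) ⟩
  fromℤ (ℤ.- a)  ≡⟨ QP.toℚᵘ-injective (UP.≃-sym (UP.≃-trans (QP.toℚᵘ-homo‿- (fromℤ a)) (U.*≡* refl))) ⟩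
  - fromℤ a      ≡⟨ sym (cong -_ (ℤ→ℚ≡fromℤ a)) ⟩
  - ℤ→ℚ a        ∎

ℤ→ℚ-- : ∀ a b → ℤ→ℚ (a ℤ.- b) ≡ ℤ→ℚ a - ℤ→ℚ b
ℤ→ℚ-- a b = trans (ℤ→ℚ-+ a (ℤ.- b)) (cong (ℤ→ℚ a +_) (ℤ→ℚ-neg b))

IsInt-ℤ : ∀ k → IsInt (ℤ→ℚ k)
IsInt-ℤ k = k , refl

IsInt-resp : ∀ {p q} → p ≡ q → IsInt p → IsInt q
IsInt-resp refl i = i

IsInt-0 : IsInt 0ℚ
IsInt-0 = IsInt-ℤ ℤ.0ℤ

IsInt-+ : ∀ {p q} → IsInt p → IsInt q → IsInt (p + q)
IsInt-+ (a , refl) (b , refl) = a ℤ.+ b , sym (ℤ→ℚ-+ a b)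

IsInt-* : ∀ {p q} → IsInt p → IsInt q → IsInt (p * q)
IsInt-* (a , refl) (b , refl) = a ℤ.* b , sym (ℤ→ℚ-* a b)

IsInt-- : ∀ {p q} → IsInt p → IsInt q → IsInt (p - q)
IsInt-- (a , refl) (b , refl) = a ℤ.- b , sym (ℤ→ℚ-- a b)

ℕ→ℚ : ℕ → ℚ
ℕ→ℚ N = ℤ→ℚ (ℤ.+ N)

IsInt-denominator* : ∀ q → IsInt (ℕ→ℚ (ℚ.denominatorℕ q) * q)
IsInt-denominator* q@(mkℚ a d _) = a , (begin
  ℕ→ℚ (suc d) * q        ≡⟨ cong (_* q) (ℤ→ℚ≡fromℤ (ℤ.+ suc d)) ⟩
  fromℤ (ℤ.+ suc d) * q  ≡⟨ QP.toℚᵘ-injective (UP.≃-trans (QP.toℚᵘ-homo-* (fromℤ (ℤ.+ suc d)) q) (U.*≡* eq)) ⟩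
  fromℤ a                ≡⟨ sym (ℤ→ℚ≡fromℤ a) ⟩
  ℤ→ℚ a                  ∎)
  where
  eq : (ℤ.+ suc d ℤ.* a) ℤ.* ℤ.+ 1 ≡ a ℤ.* ℤ.+ (1 ℕ.* suc d)
  eq = trans (ZP.*-identityʳ _) (trans (ZP.*-comm (ℤ.+ suc d) a) (cong (λ x → a ℤ.* ℤ.+ x) (sym (NP.*-identityˡ (suc d)))))

ℕ→ℚ-* : ∀ a b → ℕ→ℚ (a ℕ.* b) ≡ ℕ→ℚ a * ℕ→ℚ b
ℕ→ℚ-* a b = trans (cong ℤ→ℚ (ZP.pos-* a b)) (ℤ→ℚ-* (ℤ.+ a) (ℤ.+ b))

IsInt-*-multiple : ∀ M N {q} → IsInt (ℕ→ℚ N * q) → IsInt (ℕ→ℚ (M ℕ.* N) * q)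
IsInt-*-multiple M N {q} i =
  IsInt-resp (trans (sym (QP.*-assoc (ℕ→ℚ M) (ℕ→ℚ N) q)) (cong (_* q) (sym (ℕ→ℚ-* M N)))) (IsInt-* (IsInt-ℤ (ℤ.+ M)) i)

commonDenominator : ∀ {m} (f : Fin m → ℚ) → ∃ λ N → NonZero N × (∀ i → IsInt (ℕ→ℚ N * f i))
commonDenominator {zero} f = 1 , _ , λ ()
commonDenominator {suc m} f with commonDenominator (λ i → f (suc i))
... | N , N≢0 , cleared = d ℕ.* N , NP.m*n≢0 d N {{_}} {{N≢0}} , cleared′
  where
  d : ℕ
  d = ℚ.denominatorℕ (f zero)
  cleared′ : ∀ i → IsInt (ℕ→ℚ (d ℕ.* N) * f i)
  cleared′ zero    = subst (λ k → IsInt (ℕ→ℚ k * f zero)) (NP.*-comm N d) (IsInt-*-multiple N d (IsInt-denominator* (f zero)))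
  cleared′ (suc i) = IsInt-*-multiple d N (cleared i)

commonDenominator₂ : ∀ {m k} (g : Fin m → Fin k → ℚ) → ∃ λ N → NonZero N × (∀ i j → IsInt (ℕ→ℚ N * g i j))
commonDenominator₂ {m} {k} g with commonDenominator (λ p → uncurry g (remQuot k p))
... | N , N≢0 , cleared =
  N , N≢0 , λ i j → subst (λ ij → IsInt (ℕ→ℚ N * uncurry g ij)) (remQuot-combine i j) (cleared (combine i j))

module Sum = SemiringSum (CommutativeRing.semiring QP.+-*-commutativeRing)

∑≡sum : ∀ {n} (f : Fin n → ℚ) → ∑ f ≡ Sum.sum f
∑≡sum {zero}  f = refl
∑≡sum {suc n} f = cong (f zero +_) (∑≡sum (λ i → f (suc i)))

∑-cong : ∀ {n} {f g : Fin n → ℚ} → (∀ i → f i ≡ g i) → ∑ f ≡ ∑ g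
∑-cong {f = f} {g} f≗g = trans (∑≡sum f) (trans (Sum.sum-cong-≗ f≗g) (sym (∑≡sum g)))

∑-0 : ∀ n → ∑ {n} (λ _ → 0ℚ) ≡ 0ℚ
∑-0 n = trans (∑≡sum {n} _) (Sum.sum-replicate-zero n)

∑-+ : ∀ {n} (f g : Fin n → ℚ) → ∑ (λ i → f i + g i) ≡ ∑ f + ∑ g
∑-+ f g = begin
  ∑ (λ i → f i + g i)        ≡⟨ ∑≡sum (λ i → f i + g i) ⟩
  Sum.sum (λ i → f i + g i)  ≡⟨ Sum.∑-distrib-+ f g ⟩
  Sum.sum f + Sum.sum g      ≡⟨ sym (cong₂ _+_ (∑≡sum f) (∑≡sum g)) ⟩
  ∑ f + ∑ g                  ∎

∑-- : ∀ {n} (f g : Fin n → ℚ) → ∑ (λ i → f i - g i) ≡ ∑ f - ∑ g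
∑-- f g = begin
  ∑ (λ i → f i - g i)                ≡⟨ sym (add-sub (∑ (λ i → f i - g i)) (∑ g)) ⟩
  (∑ (λ i → f i - g i) + ∑ g) - ∑ g  ≡⟨ cong (_- ∑ g) (sym (∑-+ (λ i → f i - g i) g)) ⟩
  ∑ (λ i → (f i - g i) + g i) - ∑ g  ≡⟨ cong (_- ∑ g) (∑-cong (λ i → sub-add (f i) (g i))) ⟩
  ∑ f - ∑ g                          ∎
  where
  add-sub : ∀ x y → (x + y) - y ≡ x
  add-sub = solve-∀ ℚ-ring
  sub-add : ∀ x y → (x - y) + y ≡ x
  sub-add = solve-∀ ℚ-ring

∑-*ˡ : ∀ {n} (c : ℚ) (f : Fin n → ℚ) → ∑ (λ i → c * f i) ≡ c * ∑ f
∑-*ˡ c f = begin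
  ∑ (λ i → c * f i)        ≡⟨ ∑≡sum (λ i → c * f i) ⟩
  Sum.sum (λ i → c * f i)  ≡⟨ sym (Sum.*-distribˡ-sum c f) ⟩
  c * Sum.sum f            ≡⟨ cong (c *_) (sym (∑≡sum f)) ⟩
  c * ∑ f                  ∎

∑-*ʳ : ∀ {n} (c : ℚ) (f : Fin n → ℚ) → ∑ (λ i → f i * c) ≡ ∑ f * c
∑-*ʳ c f = trans (∑-cong (λ i → QP.*-comm (f i) c)) (trans (∑-*ˡ c f) (QP.*-comm c (∑ f)))

∑-swap : ∀ {m n} (f : Fin m → Fin n → ℚ) → ∑ (λ i → ∑ (λ j → f i j)) ≡ ∑ (λ j → ∑ (λ i → f i j))
∑-swap f = begin
  ∑ (λ i → ∑ (λ j → f i j))              ≡⟨ ∑∑≡sum-sum f ⟩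
  Sum.sum (λ i → Sum.sum (λ j → f i j))  ≡⟨ Sum.∑-comm f ⟩
  Sum.sum (λ j → Sum.sum (λ i → f i j))  ≡⟨ sym (∑∑≡sum-sum (λ j i → f i j)) ⟩
  ∑ (λ j → ∑ (λ i → f i j))              ∎
  where
  ∑∑≡sum-sum : ∀ {m n} (g : Fin m → Fin n → ℚ) → ∑ (λ i → ∑ (g i)) ≡ Sum.sum (λ i → Sum.sum (g i))
  ∑∑≡sum-sum g = trans (∑-cong (λ i → ∑≡sum (g i))) (∑≡sum (λ i → Sum.sum (g i)))

∑-idMat : ∀ {n} (v : Vect n) (i : Fin n) → ∑ (λ j → idMat i j * v j) ≡ v i
∑-idMat {suc n} v zero = begin
  1ℚ * v zero + ∑ (λ j → 0ℚ * v (suc j))  ≡⟨ cong₂ _+_ (QP.*-identityˡ (v zero)) (trans (∑-cong (λ j → QP.*-zeroˡ (v (suc j)))) (∑-0 n)) ⟩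
  v zero + 0ℚ                            ≡⟨ QP.+-identityʳ (v zero) ⟩
  v zero                                 ∎
∑-idMat {suc n} v (suc i) = begin
  0ℚ * v zero + ∑ (λ j → idMat i j * v (suc j))  ≡⟨ cong₂ _+_ (QP.*-zeroˡ (v zero)) (∑-idMat (λ j → v (suc j)) i) ⟩
  0ℚ + v (suc i)                                ≡⟨ QP.+-identityˡ (v (suc i)) ⟩
  v (suc i)                                     ∎

∑-IsInt : ∀ {n} (f : Fin n → ℚ) → (∀ i → IsInt (f i)) → IsInt (∑ f)
∑-IsInt {zero}  f _   = IsInt-0
∑-IsInt {suc n} f int = IsInt-+ (int zero) (∑-IsInt (λ i → f (suc i)) (λ i → int (suc i)))

_⊙_ : ∀ {n} → ℚ → Vect n → Vect n
(c ⊙ v) i = c * v i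

≈-refl : ∀ {n} {v : Vect n} → v ≈ v
≈-refl i = refl

≈-sym : ∀ {n} {v w : Vect n} → v ≈ w → w ≈ v
≈-sym e i = sym (e i)

≈-trans : ∀ {n} {u v w : Vect n} → u ≈ v → v ≈ w → u ≈ w
≈-trans e f i = trans (e i) (f i)

apply-cong : ∀ {n} (M : Mat n) {v w : Vect n} → v ≈ w → apply M v ≈ apply M w
apply-cong M e i = ∑-cong (λ j → cong (M i j *_) (e j))

apply-0 : ∀ {n} (M : Mat n) → apply M 0v ≈ 0v
apply-0 {n} M i = trans (∑-cong (λ j → QP.*-zeroʳ (M i j))) (∑-0 n)

apply-⊕ : ∀ {n} (M : Mat n) (v w : Vect n) → apply M (v ⊕ w) ≈ (apply M v ⊕ apply M w)
apply-⊕ M v w i = trans (∑-cong (λ j → QP.*-distribˡ-+ (M i j) (v j) (w j))) (∑-+ (λ j → M i j * v j) (λ j → M i j * w j))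

apply-⊖ : ∀ {n} (M : Mat n) (v w : Vect n) → apply M (v ⊖ w) ≈ (apply M v ⊖ apply M w)
apply-⊖ M v w i = trans (∑-cong (λ j → distrib (M i j) (v j) (w j))) (∑-- (λ j → M i j * v j) (λ j → M i j * w j))
  where
  distrib : ∀ m a b → m * (a - b) ≡ m * a - m * b
  distrib = solve-∀ ℚ-ring

apply-⊙ : ∀ {n} (M : Mat n) (c : ℚ) (v : Vect n) → apply M (c ⊙ v) ≈ (c ⊙ apply M v)
apply-⊙ M c v i = trans (∑-cong (λ j → swap (M i j) c (v j))) (∑-*ˡ c (λ j → M i j * v j))
  where
  swap : ∀ m c a → m * (c * a) ≡ c * (m * a)
  swap = solve-∀ ℚ-ring

apply-idMat : ∀ {n} (v : Vect n) → apply idMat v ≈ v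
apply-idMat = ∑-idMat

apply-1+D : ∀ {n} (D : Mat n) (v : Vect n) → apply (idMat +M D) v ≈ (v ⊕ apply D v)
apply-1+D D v i = begin
  apply (idMat +M D) v i                          ≡⟨ ∑-cong (λ j → QP.*-distribʳ-+ (v j) (idMat i j) (D i j)) ⟩
  ∑ (λ j → idMat i j * v j + D i j * v j)         ≡⟨ ∑-+ (λ j → idMat i j * v j) (λ j → D i j * v j) ⟩
  apply idMat v i + apply D v i                   ≡⟨ cong (_+ apply D v i) (apply-idMat v i) ⟩
  v i + apply D v i                               ∎

apply-1+D⊖id : ∀ {n} (D : Mat n) (v : Vect n) → (apply (idMat +M D) v ⊖ v) ≈ apply D v
apply-1+D⊖id D v i = trans (cong (_- v i) (apply-1+D D v i)) (cancel (v i) (apply D v i))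
  where
  cancel : ∀ x y → (x + y) - x ≡ y
  cancel = solve-∀ ℚ-ring

∑∑-cong : ∀ {n} {f g : Fin n → Fin n → ℚ} → (∀ i j → f i j ≡ g i j) →
          ∑ (λ i → ∑ (λ j → f i j)) ≡ ∑ (λ i → ∑ (λ j → g i j))
∑∑-cong e = ∑-cong (λ i → ∑-cong (e i))

∑∑-+ : ∀ {n} (f g : Fin n → Fin n → ℚ) →
       ∑ (λ i → ∑ (λ j → f i j + g i j)) ≡ ∑ (λ i → ∑ (λ j → f i j)) + ∑ (λ i → ∑ (λ j → g i j))
∑∑-+ f g = trans (∑-cong (λ i → ∑-+ (f i) (g i))) (∑-+ (λ i → ∑ (f i)) (λ i → ∑ (g i)))

∑∑-- : ∀ {n} (f g : Fin n → Fin n → ℚ) →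
       ∑ (λ i → ∑ (λ j → f i j - g i j)) ≡ ∑ (λ i → ∑ (λ j → f i j)) - ∑ (λ i → ∑ (λ j → g i j))
∑∑-- f g = trans (∑-cong (λ i → ∑-- (f i) (g i))) (∑-- (λ i → ∑ (f i)) (λ i → ∑ (g i)))

∑∑-*ˡ : ∀ {n} (c : ℚ) (f : Fin n → Fin n → ℚ) →
        ∑ (λ i → ∑ (λ j → c * f i j)) ≡ c * ∑ (λ i → ∑ (λ j → f i j))
∑∑-*ˡ c f = trans (∑-cong (λ i → ∑-*ˡ c (f i))) (∑-*ˡ c (λ i → ∑ (f i)))

pair-cong : ∀ {n} (B : Mat n) {v v′ w w′ : Vect n} → v ≈ v′ → w ≈ w′ → pair B v w ≡ pair B v′ w′
pair-cong B v≈v′ w≈w′ = ∑∑-cong (λ i j → cong₂ (λ a b → a * B i j * b) (v≈v′ i) (w≈w′ j))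

pair-0ˡ : ∀ {n} (B : Mat n) (w : Vect n) → pair B 0v w ≡ 0ℚ
pair-0ˡ {n} B w = begin
  pair B 0v w                                ≡⟨ ∑∑-cong (λ i j → zero-left (B i j) (w j)) ⟩
  ∑ (λ (_ : Fin n) → ∑ {n} (λ _ → 0ℚ))       ≡⟨ ∑-cong {g = λ (_ : Fin n) → 0ℚ} (λ _ → ∑-0 n) ⟩
  ∑ {n} (λ _ → 0ℚ)                           ≡⟨ ∑-0 n ⟩
  0ℚ                                         ∎
  where
  zero-left : ∀ b c → 0ℚ * b * c ≡ 0ℚ
  zero-left = solve-∀ ℚ-ring

pair-⊕ˡ : ∀ {n} (B : Mat n) (v v′ w : Vect n) → pair B (v ⊕ v′) w ≡ pair B v w + pair B v′ w
pair-⊕ˡ B v v′ w = trans (∑∑-cong (λ i j → distrib (v i) (v′ i) (B i j) (w j)))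
  (∑∑-+ (λ i j → v i * B i j * w j) (λ i j → v′ i * B i j * w j))
  where
  distrib : ∀ a a′ b c → (a + a′) * b * c ≡ a * b * c + a′ * b * c
  distrib = solve-∀ ℚ-ring

pair-⊖ˡ : ∀ {n} (B : Mat n) (v v′ w : Vect n) → pair B (v ⊖ v′) w ≡ pair B v w - pair B v′ w
pair-⊖ˡ B v v′ w = trans (∑∑-cong (λ i j → distrib (v i) (v′ i) (B i j) (w j)))
  (∑∑-- (λ i j → v i * B i j * w j) (λ i j → v′ i * B i j * w j))
  where
  distrib : ∀ a a′ b c → (a - a′) * b * c ≡ a * b * c - a′ * b * c
  distrib = solve-∀ ℚ-ring

pair-⊖ʳ : ∀ {n} (B : Mat n) (v w w′ : Vect n) → pair B v (w ⊖ w′) ≡ pair B v w - pair B v w′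
pair-⊖ʳ B v w w′ = trans (∑∑-cong (λ i j → distrib (v i) (B i j) (w j) (w′ j)))
  (∑∑-- (λ i j → v i * B i j * w j) (λ i j → v i * B i j * w′ j))
  where
  distrib : ∀ a b c c′ → a * b * (c - c′) ≡ a * b * c - a * b * c′
  distrib = solve-∀ ℚ-ring

pair-⊙ˡ : ∀ {n} (B : Mat n) (c : ℚ) (v w : Vect n) → pair B (c ⊙ v) w ≡ c * pair B v w
pair-⊙ˡ B c v w = trans (∑∑-cong (λ i j → assoc c (v i) (B i j) (w j))) (∑∑-*ˡ c (λ i j → v i * B i j * w j))
  where
  assoc : ∀ k a b d → k * a * b * d ≡ k * (a * b * d)
  assoc = solve-∀ ℚ-ring

pair-sym : ∀ {n} (B : Mat n) → (∀ i j → B i j ≡ B j i) → ∀ v w → pair B v w ≡ pair B w v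
pair-sym B B-sym v w = trans (∑-swap (λ i j → v i * B i j * w j)) (∑∑-cong (λ j i → flip (v i) (B i j) (B j i) (w j) (B-sym i j)))
  where
  reverse : ∀ a b c → a * b * c ≡ c * b * a
  reverse = solve-∀ ℚ-ring
  flip : ∀ a b b′ c → b ≡ b′ → a * b * c ≡ c * b′ * a
  flip a b .b c refl = reverse a b c

col : ∀ {n} → Mat n → Fin n → Vect n
col L j k = L k j

pair-apply : ∀ {n} (B L : Mat n) (v w : Vect n) → pair B v (apply L w) ≡ ∑ (λ j → pair B v (col L j) * w j)
pair-apply B L v w = begin
  ∑ (λ i → ∑ (λ k → v i * B i k * ∑ (λ j → L k j * w j)))
    ≡⟨ ∑∑-cong (λ i k → sym (trans (∑-cong (λ j → assoc (v i * B i k) (L k j) (w j))) (∑-*ˡ (v i * B i k) (λ j → L k j * w j)))) ⟩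
  ∑ (λ i → ∑ (λ k → ∑ (λ j → v i * B i k * L k j * w j)))
    ≡⟨ ∑-cong (λ i → ∑-swap (λ k j → v i * B i k * L k j * w j)) ⟩
  ∑ (λ i → ∑ (λ j → ∑ (λ k → v i * B i k * L k j * w j)))
    ≡⟨ ∑-swap (λ i j → ∑ (λ k → v i * B i k * L k j * w j)) ⟩
  ∑ (λ j → ∑ (λ i → ∑ (λ k → v i * B i k * L k j * w j)))
    ≡⟨ ∑-cong (λ j → trans (∑-cong (λ i → ∑-*ʳ (w j) (λ k → v i * B i k * L k j))) (∑-*ʳ (w j) (λ i → ∑ (λ k → v i * B i k * L k j)))) ⟩
  ∑ (λ j → pair B v (col L j) * w j) ∎
  where
  assoc : ∀ a b c → a * b * c ≡ a * (b * c)
  assoc = solve-∀ ℚ-ring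

gram : ∀ {n} → Mat n → Mat n → Mat n
gram B L i j = pair B (col L i) (col L j)

pair-apply-apply : ∀ {n} (B L : Mat n) → (∀ i j → B i j ≡ B j i) →
                   ∀ u w → pair B (apply L u) (apply L w) ≡ pair (gram B L) u w
pair-apply-apply B L B-sym u w = begin
  pair B (apply L u) (apply L w)
    ≡⟨ pair-apply B L (apply L u) w ⟩
  ∑ (λ j → pair B (apply L u) (col L j) * w j)
    ≡⟨ ∑-cong (λ j → cong (_* w j) (trans (pair-sym B B-sym (apply L u) (col L j)) (pair-apply B L (col L j) u))) ⟩
  ∑ (λ j → ∑ (λ i → G j i * u i) * w j)
    ≡⟨ ∑-cong (λ j → sym (∑-*ʳ (w j) (λ i → G j i * u i))) ⟩
  ∑ (λ j → ∑ (λ i → G j i * u i * w j))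
    ≡⟨ sym (∑-swap (λ i j → G j i * u i * w j)) ⟩
  ∑ (λ i → ∑ (λ j → G j i * u i * w j))
    ≡⟨ ∑∑-cong (λ i j → rearrange (G j i) (G i j) (u i) (w j) (pair-sym B B-sym (col L j) (col L i))) ⟩
  pair G u w ∎
  where
  G : Mat _
  G = gram B L
  swap : ∀ g a b → g * a * b ≡ a * g * b
  swap = solve-∀ ℚ-ring
  rearrange : ∀ g g′ a b → g ≡ g′ → g * a * b ≡ a * g′ * b
  rearrange g .g a b refl = swap g a b

pair-IsInt : ∀ {n} (c : ℚ) (G : Mat n) (u w : Vect n) → (∀ i j → IsInt (c * G i j)) →
             (∀ i → IsInt (u i)) → (∀ j → IsInt (w j)) → IsInt (c * pair G u w)
pair-IsInt c G u w cG-int u-int w-int =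
  IsInt-resp (trans (∑∑-cong (λ i j → assoc (u i) c (G i j) (w j))) (∑∑-*ˡ c (λ i j → u i * G i j * w j)))
    (∑-IsInt _ (λ i → ∑-IsInt _ (λ j → IsInt-* (IsInt-* (u-int i) (cG-int i j)) (w-int j))))
  where
  assoc : ∀ a k g b → a * (k * g) * b ≡ k * (a * g * b)
  assoc = solve-∀ ℚ-ring

record IsAdditiveSubgroup {n} (M : Subset n) : Set where
  field
    ∈-resp-≈ : ∀ {v w} → v ≈ w → M v → M w
    0∈       : M 0v
    ⊕-closed : ∀ {v w} → M v → M w → M (v ⊕ w)
    ⊖-closed : ∀ {v w} → M v → M w → M (v ⊖ w)

ℤ→ℚⁿ : ∀ {n} → (Fin n → ℤ) → Vect n
ℤ→ℚⁿ z j = ℤ→ℚ (z j)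

latticeOf-isAdditiveSubgroup : ∀ {n} (L : Mat n) → IsAdditiveSubgroup (latticeOf L)
latticeOf-isAdditiveSubgroup L = record
  { ∈-resp-≈ = λ v≈w (z , v≈Lz) → z , ≈-trans (≈-sym v≈w) v≈Lz
  ; 0∈       = (λ _ → ℤ.0ℤ) , ≈-sym (apply-0 L)
  ; ⊕-closed = λ {v} {w} (z , v≈Lz) (z′ , w≈Lz′) → (λ j → z j ℤ.+ z′ j) , λ i → begin
      v i + w i                                  ≡⟨ cong₂ _+_ (v≈Lz i) (w≈Lz′ i) ⟩
      apply L (ℤ→ℚⁿ z) i + apply L (ℤ→ℚⁿ z′) i   ≡⟨ sym (apply-⊕ L (ℤ→ℚⁿ z) (ℤ→ℚⁿ z′) i) ⟩
      apply L (ℤ→ℚⁿ z ⊕ ℤ→ℚⁿ z′) i              ≡⟨ apply-cong L (λ j → sym (ℤ→ℚ-+ (z j) (z′ j))) i ⟩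
      apply L (ℤ→ℚⁿ (λ j → z j ℤ.+ z′ j)) i      ∎
  ; ⊖-closed = λ {v} {w} (z , v≈Lz) (z′ , w≈Lz′) → (λ j → z j ℤ.- z′ j) , λ i → begin
      v i - w i                                  ≡⟨ cong₂ _-_ (v≈Lz i) (w≈Lz′ i) ⟩
      apply L (ℤ→ℚⁿ z) i - apply L (ℤ→ℚⁿ z′) i   ≡⟨ sym (apply-⊖ L (ℤ→ℚⁿ z) (ℤ→ℚⁿ z′) i) ⟩
      apply L (ℤ→ℚⁿ z ⊖ ℤ→ℚⁿ z′) i              ≡⟨ apply-cong L (λ j → sym (ℤ→ℚ-- (z j) (z′ j))) i ⟩
      apply L (ℤ→ℚⁿ (λ j → z j ℤ.- z′ j)) i      ∎
  }

dual-isAdditiveSubgroup : ∀ {n} (B : Mat n) (Λ : Subset n) → IsAdditiveSubgroup (dual B Λ)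
dual-isAdditiveSubgroup B Λ = record
  { ∈-resp-≈ = λ v≈w v∈ l l∈ → IsInt-resp (pair-cong B v≈w ≈-refl) (v∈ l l∈)
  ; 0∈       = λ l _ → IsInt-resp (sym (pair-0ˡ B l)) IsInt-0
  ; ⊕-closed = λ {v} {w} v∈ w∈ l l∈ → IsInt-resp (sym (pair-⊕ˡ B v w l)) (IsInt-+ (v∈ l l∈) (w∈ l l∈))
  ; ⊖-closed = λ {v} {w} v∈ w∈ l l∈ → IsInt-resp (sym (pair-⊖ˡ B v w l)) (IsInt-- (v∈ l l∈) (w∈ l l∈))
  }

latticeOf-scaled⊆dual : ∀ {n} (B L : Mat n) → (∀ i j → B i j ≡ B j i) →
                        ∃ λ N → NonZero N × (∀ v → latticeOf L v → dual B (latticeOf L) (ℕ→ℚ N ⊙ v))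
latticeOf-scaled⊆dual B L B-sym with commonDenominator₂ (gram B L)
... | N , N≢0 , N-clears = N , N≢0 , λ v (z , v≈Lz) l (z′ , l≈Lz′) →
  IsInt-resp (sym (eq v l z z′ v≈Lz l≈Lz′))
    (pair-IsInt (ℕ→ℚ N) (gram B L) (ℤ→ℚⁿ z) (ℤ→ℚⁿ z′) N-clears (λ i → IsInt-ℤ (z i)) (λ j → IsInt-ℤ (z′ j)))
  where
  eq : ∀ v l z z′ → v ≈ apply L (ℤ→ℚⁿ z) → l ≈ apply L (ℤ→ℚⁿ z′) →
       pair B (ℕ→ℚ N ⊙ v) l ≡ ℕ→ℚ N * pair (gram B L) (ℤ→ℚⁿ z) (ℤ→ℚⁿ z′)
  eq v l z z′ v≈Lz l≈Lz′ = begin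
    pair B (ℕ→ℚ N ⊙ v) l                          ≡⟨ pair-⊙ˡ B (ℕ→ℚ N) v l ⟩
    ℕ→ℚ N * pair B v l                            ≡⟨ cong (ℕ→ℚ N *_) (pair-cong B v≈Lz l≈Lz′) ⟩
    ℕ→ℚ N * pair B (apply L (ℤ→ℚⁿ z)) (apply L (ℤ→ℚⁿ z′)) ≡⟨ cong (ℕ→ℚ N *_) (pair-apply-apply B L B-sym (ℤ→ℚⁿ z) (ℤ→ℚⁿ z′)) ⟩
    ℕ→ℚ N * pair (gram B L) (ℤ→ℚⁿ z) (ℤ→ℚⁿ z′)    ∎

module _ {c ℓ} (S : Setoid c ℓ) where
  open Setoid S using (Carrier) renaming (_≈_ to _∼_)
  private module S = Setoid S
  open Enumerates S using (IsEnumeration)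

  fold-cancel : ∀ {h : Carrier → Carrier} → (∀ {x y} → h x ∼ h y → x ∼ y) →
                ∀ k {x y} → fold x h k ∼ fold y h k → x ∼ y
  fold-cancel h-inj zero    eq = eq
  fold-cancel h-inj (suc k) eq = fold-cancel h-inj k (h-inj eq)

  module _ {xs} (enum : IsEnumeration xs) where

    enumIndex : Carrier → Fin (length xs)
    enumIndex x = Any.index (enum x)

    enumIndex-injective : ∀ {a b} → enumIndex a ≡ enumIndex b → a ∼ b
    enumIndex-injective {a} {b} eq = S.trans (lookup-index (enum a))
      (S.trans (S.reflexive (cong (Data.List.lookup xs) eq)) (S.sym (lookup-index (enum b))))

    -- Pigeonhole on the indices of y, h y, …, hᵏ y (k = length xs) gives hⁱ y ∼ hʲ y with
    -- i < j; cancelling hⁱ leaves y ∼ h (h^(j-i-1) y).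
    injective⇒surjective : (h : Carrier → Carrier) → (∀ {x y} → h x ∼ h y → x ∼ y) →
                           ∀ y → ∃ λ x → h x ∼ y
    injective⇒surjective h h-inj y
      with i , j , i<j , same-index ← pigeonhole (NP.n<1+n (length xs)) (λ k → enumIndex (fold y h (toℕ k)))
      with o , 1+i+o≡j ← NP.m≤n⇒∃[o]m+o≡n i<j
      = fold y h o , S.sym (fold-cancel h-inj (toℕ i) (S.trans (enumIndex-injective same-index) (S.reflexive j-th)))
      where
      j-th : fold y h (toℕ j) ≡ fold (h (fold y h o)) h (toℕ i)
      j-th = trans (cong (fold y h) (trans (sym 1+i+o≡j) (sym (NP.+-suc (toℕ i) o)))) (fold-+ y h (toℕ i))

quotientSetoid : ∀ {n} (Λ M : Subset n) → IsAdditiveSubgroup M → Setoid 0ℓ 0ℓ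
quotientSetoid Λ M M-sub = record
  { Carrier       = Elem Λ
  ; _≈_           = λ x y → M (proj₁ x ⊖ proj₁ y)
  ; isEquivalence = record
    { refl  = λ {x} → ∈-resp-≈ (λ i → sym (QP.+-inverseʳ (proj₁ x i))) 0∈
    ; sym   = λ {x} {y} x∼y → ∈-resp-≈ (λ i → negate (proj₁ x i) (proj₁ y i)) (⊖-closed 0∈ x∼y)
    ; trans = λ {x} {y} {z} x∼y y∼z → ∈-resp-≈ (λ i → chain (proj₁ x i) (proj₁ y i) (proj₁ z i)) (⊕-closed x∼y y∼z)
    }
  }
  where
  open IsAdditiveSubgroup M-sub
  negate : ∀ a b → 0ℚ - (a - b) ≡ b - a
  negate = solve-∀ ℚ-ring
  chain : ∀ a b c → (a - b) + (b - c) ≡ a - c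
  chain = solve-∀ ℚ-ring

boundedVecs : (N n : ℕ) → List (Vec ℕ n)
boundedVecs N zero    = [] ∷ []
boundedVecs N (suc n) = cartesianProductWith _∷_ (upTo N) (boundedVecs N n)

tabulate∈boundedVecs : ∀ {N n} (f : Fin n → ℕ) → (∀ j → f j ℕ.< N) → tabulate f ∈ boundedVecs N n
tabulate∈boundedVecs {n = zero}  f f<N = here refl
tabulate∈boundedVecs {n = suc n} f f<N =
  ∈-cartesianProductWith⁺ _∷_ (∈-upTo⁺ (f<N zero)) (tabulate∈boundedVecs (λ j → f (suc j)) (λ j → f<N (suc j)))

latticeOf-quotient-enumerable :
  ∀ {n} (L : Mat n) (M : Subset n) (M-sub : IsAdditiveSubgroup M) (N : ℕ) .{{_ : NonZero N}} →
  (∀ v → latticeOf L v → M (ℕ→ℚ N ⊙ v)) →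
  ∃ λ xs → Enumerates.IsEnumeration (quotientSetoid (latticeOf L) M M-sub) xs
latticeOf-quotient-enumerable {n} L M M-sub N NΛ⊆M = map representative (boundedVecs N n) , covered
  where
  open IsAdditiveSubgroup M-sub
  representative : Vec ℕ n → Elem (latticeOf L)
  representative r = apply L (λ j → ℕ→ℚ (lookup r j)) , (λ j → ℤ.+ lookup r j) , ≈-refl
  -- L z is congruent to L (z mod N) modulo N·Λ ⊆ M.
  covered : ∀ x → Any.Any (λ y → M (proj₁ x ⊖ proj₁ y)) (map representative (boundedVecs N n))
  covered (v , z , v≈Lz) = map⁺ (Any.map (λ { refl → reduced }) (tabulate∈boundedVecs r r<N))
    where
    r : Fin n → ℕ
    r j = z j %ℕ N
    r<N : ∀ j → r j ℕ.< N
    r<N j = n%ℕd<d (z j) N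
    q : Fin n → ℤ
    q j = z j /ℕ N
    coordinate : ∀ j → ℤ→ℚ (z j) - ℕ→ℚ (lookup (tabulate r) j) ≡ ℕ→ℚ N * ℤ→ℚ (q j)
    coordinate j = begin
      ℤ→ℚ (z j) - ℕ→ℚ (lookup (tabulate r) j)
        ≡⟨ cong₂ (λ a b → ℤ→ℚ a - ℕ→ℚ b) (a≡a%ℕn+[a/ℕn]*n (z j) N) (lookup∘tabulate r j) ⟩
      ℤ→ℚ (ℤ.+ r j ℤ.+ q j ℤ.* ℤ.+ N) - ℕ→ℚ (r j)
        ≡⟨ cong (_- ℕ→ℚ (r j)) (trans (ℤ→ℚ-+ (ℤ.+ r j) (q j ℤ.* ℤ.+ N)) (cong (ℕ→ℚ (r j) +_) (ℤ→ℚ-* (q j) (ℤ.+ N)))) ⟩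
      (ℕ→ℚ (r j) + ℤ→ℚ (q j) * ℕ→ℚ N) - ℕ→ℚ (r j)
        ≡⟨ cancel (ℕ→ℚ (r j)) (ℤ→ℚ (q j)) (ℕ→ℚ N) ⟩
      ℕ→ℚ N * ℤ→ℚ (q j)
        ∎
      where
      cancel : ∀ a b c → (a + b * c) - a ≡ c * b
      cancel = solve-∀ ℚ-ring
    reduced : M (v ⊖ proj₁ (representative (tabulate r)))
    reduced = ∈-resp-≈ (λ i → sym (begin
      v i - apply L ρ i                           ≡⟨ cong (_- apply L ρ i) (v≈Lz i) ⟩
      apply L (ℤ→ℚⁿ z) i - apply L ρ i            ≡⟨ sym (apply-⊖ L (ℤ→ℚⁿ z) ρ i) ⟩
      apply L (λ j → ℤ→ℚ (z j) - ρ j) i          ≡⟨ apply-cong L coordinate i ⟩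
      apply L (ℕ→ℚ N ⊙ ℤ→ℚⁿ q) i                 ≡⟨ apply-⊙ L (ℕ→ℚ N) (ℤ→ℚⁿ q) i ⟩
      ℕ→ℚ N * apply L (ℤ→ℚⁿ q) i                 ∎))
      (NΛ⊆M (apply L (ℤ→ℚⁿ q)) (q , ≈-refl))
      where
      ρ : Vect n
      ρ j = ℕ→ℚ (lookup (tabulate r) j)

module _ {n} (B F L : Mat n) (B-sym : ∀ i j → B i j ≡ B j i)
         (F-isometry : ∀ v w → pair B (apply F v) (apply F w) ≡ pair B v w)
         (F-stable : ∀ v → latticeOf L v → latticeOf L (apply F v)) where

  private
    Λ Λ^∨ : Subset n
    Λ   = latticeOf L
    Λ^∨ = dual B Λ

    Λ^∨-sub : IsAdditiveSubgroup Λ^∨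
    Λ^∨-sub = dual-isAdditiveSubgroup B Λ

  isometry-injective-mod-dual : ∀ x y → Λ^∨ (apply F x ⊖ apply F y) → Λ^∨ (x ⊖ y)
  isometry-injective-mod-dual x y Fx-Fy∈Λ^∨ l l∈Λ = IsInt-resp eq (Fx-Fy∈Λ^∨ (apply F l) (F-stable l l∈Λ))
    where
    eq : pair B (apply F x ⊖ apply F y) (apply F l) ≡ pair B (x ⊖ y) l
    eq = trans (pair-cong B (≈-sym (apply-⊖ F x y)) ≈-refl) (F-isometry (x ⊖ y) l)

  isometry-surjective-mod-dual : ∀ l → Λ l → ∃ λ (m : Elem Λ) → Λ^∨ (apply F (proj₁ m) ⊖ l)
  isometry-surjective-mod-dual l l∈Λ =
    let N , N≢0 , NΛ⊆Λ^∨ = latticeOf-scaled⊆dual B L B-sym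
        _ , enum         = latticeOf-quotient-enumerable L Λ^∨ Λ^∨-sub N {{N≢0}} NΛ⊆Λ^∨
    in injective⇒surjective (quotientSetoid Λ Λ^∨ Λ^∨-sub) enum F-on-Λ
         (λ {x} {y} → isometry-injective-mod-dual (proj₁ x) (proj₁ y)) (l , l∈Λ)
    where
    F-on-Λ : Elem Λ → Elem Λ
    F-on-Λ (v , v∈Λ) = apply F v , F-stable v v∈Λ

  isometry-preserves-dual : Λ^∨ ⊆ Λ → ∀ v → Λ^∨ v → Λ^∨ (apply F v)
  isometry-preserves-dual Λ^∨⊆Λ v v∈Λ^∨ l l∈Λ =
    let (m , m∈Λ) , Fm-l∈Λ^∨ = isometry-surjective-mod-dual l l∈Λ
    in IsInt-resp (sym (split m))
         (IsInt-- (IsInt-resp (sym (F-isometry v m)) (v∈Λ^∨ m m∈Λ))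
                  (IsInt-resp (pair-sym B B-sym (apply F m ⊖ l) (apply F v))
                              (Fm-l∈Λ^∨ (apply F v) (F-stable v (Λ^∨⊆Λ v v∈Λ^∨)))))
    where
    split : ∀ m → pair B (apply F v) l ≡ pair B (apply F v) (apply F m) - pair B (apply F v) (apply F m ⊖ l)
    split m = begin
      pair B Fv l                                  ≡⟨ sym (sub-sub (pair B Fv Fm) (pair B Fv l)) ⟩
      pair B Fv Fm - (pair B Fv Fm - pair B Fv l)  ≡⟨ cong (λ t → pair B Fv Fm - t) (sym (pair-⊖ʳ B Fv Fm l)) ⟩
      pair B Fv Fm - pair B Fv (Fm ⊖ l)            ∎
      where
      sub-sub : ∀ a b → a - (a - b) ≡ b
      sub-sub = solve-∀ ℚ-ring
      Fv Fm : Vect n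
      Fv = apply F v
      Fm = apply F m

D-kills-ker : ∀ {n} (D : Mat n) {u w k : Vect n} → u ≈ (w ⊕ k) → ker D k → apply D u ≈ apply D w
D-kills-ker D {u} {w} {k} u≈w+k Dk≈0 i = begin
  apply D u i                  ≡⟨ apply-cong D u≈w+k i ⟩
  apply D (w ⊕ k) i            ≡⟨ apply-⊕ D w k i ⟩
  apply D w i + apply D k i    ≡⟨ cong (apply D w i +_) (Dk≈0 i) ⟩
  apply D w i + 0ℚ             ≡⟨ QP.+-identityʳ (apply D w i) ⟩
  apply D w i                  ∎

preimage-quotient≅image-quotient :
  ∀ {n} (D : Mat n) {M M′ : Subset n} → IsAdditiveSubgroup M → IsAdditiveSubgroup M′ →
  QuotIso (M +S preimg D M′) (M +S ker D) (M′ ∩S img D whole) (M′ ∩S img D M)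
preimage-quotient≅image-quotient D {M} {M′} M-sub M′-sub = record
  { f          = f
  ; well-def   = well-def
  ; additive   = additive
  ; injective  = injective
  ; surjective = surjective
  }
  where
  module M  = IsAdditiveSubgroup M-sub
  module M′ = IsAdditiveSubgroup M′-sub

  f : Elem (M +S preimg D M′) → Elem (M′ ∩S img D whole)
  f (_ , _ , b , _ , Db∈M′ , _) = apply D b , Db∈M′ , b , _ , ≈-refl

  well-def : ∀ x y → (M +S ker D) (proj₁ x ⊖ proj₁ y) → (M′ ∩S img D M) (proj₁ (f x) ⊖ proj₁ (f y))
  well-def (x , a , b , a∈M , Db∈M′ , x≈a+b) (y , a′ , b′ , a′∈M , Db′∈M′ , y≈a′+b′) (l , k , l∈M , k∈ker , x-y≈l+k) =
    M′.⊖-closed Db∈M′ Db′∈M′ ,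
    l ⊖ (a ⊖ a′) , M.⊖-closed l∈M (M.⊖-closed a∈M a′∈M) ,
    ≈-trans (≈-sym (apply-⊖ D b b′)) (D-kills-ker D b-b′≈ k∈ker)
    where
    shuffle : ∀ x y a b a′ b′ l k → x ≡ a + b → y ≡ a′ + b′ → x - y ≡ l + k → b - b′ ≡ (l - (a - a′)) + k
    shuffle x y a b a′ b′ l k refl refl eq = trans (identity a b a′ b′) (trans (cong (_- (a - a′)) eq) (identity′ l k a a′))
      where
      identity : ∀ a b a′ b′ → b - b′ ≡ ((a + b) - (a′ + b′)) - (a - a′)
      identity = solve-∀ ℚ-ring
      identity′ : ∀ l k a a′ → (l + k) - (a - a′) ≡ (l - (a - a′)) + k
      identity′ = solve-∀ ℚ-ring
    b-b′≈ : (b ⊖ b′) ≈ ((l ⊖ (a ⊖ a′)) ⊕ k)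
    b-b′≈ i = shuffle (x i) (y i) (a i) (b i) (a′ i) (b′ i) (l i) (k i) (x≈a+b i) (y≈a′+b′ i) (x-y≈l+k i)

  additive : ∀ x y z → proj₁ z ≈ (proj₁ x ⊕ proj₁ y) →
             (M′ ∩S img D M) (proj₁ (f z) ⊖ (proj₁ (f x) ⊕ proj₁ (f y)))
  additive (x , ax , bx , ax∈M , Dbx∈M′ , x≈) (y , ay , by , ay∈M , Dby∈M′ , y≈) (z , az , bz , az∈M , Dbz∈M′ , z≈) z≈x+y =
    M′.⊖-closed Dbz∈M′ (M′.⊕-closed Dbx∈M′ Dby∈M′) ,
    (ax ⊕ ay) ⊖ az , M.⊖-closed (M.⊕-closed ax∈M ay∈M) az∈M ,
    λ i → begin
      apply D bz i - (apply D bx i + apply D by i) ≡⟨ cong (λ t → apply D bz i - t) (sym (apply-⊕ D bx by i)) ⟩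
      apply D bz i - apply D (bx ⊕ by) i           ≡⟨ sym (apply-⊖ D bz (bx ⊕ by) i) ⟩
      apply D (bz ⊖ (bx ⊕ by)) i                   ≡⟨ apply-cong D (λ j → rebalance (ax j) (bx j) (ay j) (by j) (az j) (bz j) (z≈x+y j) (x≈ j) (y≈ j) (z≈ j)) i ⟩
      apply D ((ax ⊕ ay) ⊖ az) i                   ∎
    where
    rebalance : ∀ {x y z} ax bx ay by az bz → z ≡ x + y → x ≡ ax + bx → y ≡ ay + by → z ≡ az + bz →
                bz - (bx + by) ≡ (ax + ay) - az
    rebalance ax bx ay by az bz refl refl refl eq = begin
      bz - (bx + by)                          ≡⟨ identity az bz bx by ⟩
      ((az + bz) - (bx + by)) - az            ≡⟨ cong (λ t → (t - (bx + by)) - az) (sym eq) ⟩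
      (((ax + bx) + (ay + by)) - (bx + by)) - az ≡⟨ identity′ ax bx ay by az ⟩
      (ax + ay) - az                          ∎
      where
      identity : ∀ az bz bx by → bz - (bx + by) ≡ ((az + bz) - (bx + by)) - az
      identity = solve-∀ ℚ-ring
      identity′ : ∀ ax bx ay by az → (((ax + bx) + (ay + by)) - (bx + by)) - az ≡ (ax + ay) - az
      identity′ = solve-∀ ℚ-ring

  injective : ∀ x y → (M′ ∩S img D M) (proj₁ (f x) ⊖ proj₁ (f y)) → (M +S ker D) (proj₁ x ⊖ proj₁ y)
  injective (x , a , b , a∈M , _ , x≈) (y , a′ , b′ , a′∈M , _ , y≈) (_ , m , m∈M , Db-Db′≈Dm) =
    (a ⊖ a′) ⊕ m , (b ⊖ b′) ⊖ m , M.⊕-closed (M.⊖-closed a∈M a′∈M) m∈M ,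
    (λ i → begin
      apply D ((b ⊖ b′) ⊖ m) i              ≡⟨ apply-⊖ D (b ⊖ b′) m i ⟩
      apply D (b ⊖ b′) i - apply D m i      ≡⟨ cong (_- apply D m i) (trans (apply-⊖ D b b′ i) (Db-Db′≈Dm i)) ⟩
      apply D m i - apply D m i             ≡⟨ QP.+-inverseʳ (apply D m i) ⟩
      0ℚ                                    ∎) ,
    λ i → regroup (a i) (b i) (a′ i) (b′ i) (m i) (x≈ i) (y≈ i)
    where
    identity : ∀ a b a′ b′ m → (a + b) - (a′ + b′) ≡ ((a - a′) + m) + ((b - b′) - m)
    identity = solve-∀ ℚ-ring
    regroup : ∀ {x y} a b a′ b′ m → x ≡ a + b → y ≡ a′ + b′ → x - y ≡ ((a - a′) + m) + ((b - b′) - m)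
    regroup a b a′ b′ m refl refl = identity a b a′ b′ m

  surjective : ∀ y → ∃ λ x → (M′ ∩S img D M) (proj₁ (f x) ⊖ proj₁ y)
  surjective (v , v∈M′ , w , _ , v≈Dw) =
    (w , 0v , w , M.0∈ , Dw∈M′ , λ i → sym (QP.+-identityˡ (w i))) ,
    M′.⊖-closed Dw∈M′ v∈M′ , 0v , M.0∈ ,
    λ i → trans (cong (λ t → apply D w i - t) (v≈Dw i)) (trans (QP.+-inverseʳ (apply D w i)) (sym (apply-0 D i)))
    where
    Dw∈M′ : M′ (apply D w)
    Dw∈M′ = M′.∈-resp-≈ v≈Dw v∈M′

1+D-trivial-on-preimage-quotient :
  ∀ {n} (D : Mat n) {M M′ : Subset n} → IsAdditiveSubgroup M →
  (∀ v → M v → M (apply (idMat +M D) v)) → M′ ⊆ M →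
  TrivialAction (idMat +M D) (M +S preimg D M′) (M +S ker D)
1+D-trivial-on-preimage-quotient D {M} M-sub F-stable M′⊆M v (a , b , a∈M , Db∈M′ , v≈a+b) =
  apply D a ⊕ apply D b , 0v , ⊕-closed Da∈M (M′⊆M (apply D b) Db∈M′) , apply-0 D ,
  λ i → begin
    apply (idMat +M D) v i - v i         ≡⟨ apply-1+D⊖id D v i ⟩
    apply D v i                          ≡⟨ trans (apply-cong D v≈a+b i) (apply-⊕ D a b i) ⟩
    apply D a i + apply D b i            ≡⟨ sym (QP.+-identityʳ _) ⟩
    (apply D a i + apply D b i) + 0ℚ     ∎
  where
  open IsAdditiveSubgroup M-sub
  Da∈M : M (apply D a)
  Da∈M = ∈-resp-≈ (apply-1+D⊖id D a) (⊖-closed (F-stable a a∈M) a∈M)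

1+D-trivial-on-image-quotient :
  ∀ {n} (D : Mat n) {M M′ : Subset n} → IsAdditiveSubgroup M′ →
  (∀ v → M′ v → M′ (apply (idMat +M D) v)) → M′ ⊆ M →
  TrivialAction (idMat +M D) (M′ ∩S img D whole) (M′ ∩S img D M)
1+D-trivial-on-image-quotient D M′-sub F-stable M′⊆M v (v∈M′ , _) =
  ⊖-closed (F-stable v v∈M′) v∈M′ , v , M′⊆M v v∈M′ , apply-1+D⊖id D v
  where open IsAdditiveSubgroup M′-sub

lemma2p3p6 : (n : ℕ) (D B L : Mat n) →
  IsAutomorphism (idMat +M D) →
  ker (D ∘M D) ⊆ ker D →
  ker D ⊆ ker (D ∘M D) →
  (∀ i j → B i j ≡ B j i) →
  (∀ v → (∀ w → pair B v w ≡ 0ℚ) → v ≈ 0v) →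
  (∀ v w → pair B (apply (idMat +M D) v) (apply (idMat +M D) w) ≡ pair B v w) →
  IsAutomorphism L →
  (∀ v → latticeOf L v → latticeOf L (apply (idMat +M D) v)) →
  dual B (latticeOf L) ⊆ latticeOf L →
  QuotIso (latticeOf L +S preimg D (dual B (latticeOf L)))
          (latticeOf L +S ker D)
          (dual B (latticeOf L) ∩S img D whole)
          (dual B (latticeOf L) ∩S img D (latticeOf L))
  × TrivialAction (idMat +M D)
      (latticeOf L +S preimg D (dual B (latticeOf L)))
      (latticeOf L +S ker D)
  × TrivialAction (idMat +M D)
      (dual B (latticeOf L) ∩S img D whole)
      (dual B (latticeOf L) ∩S img D (latticeOf L))
lemma2p3p6 n D B L _ _ _ B-sym _ F-isometry _ F-stable Λ^∨⊆Λ =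
    preimage-quotient≅image-quotient D Λ-sub Λ^∨-sub
  , 1+D-trivial-on-preimage-quotient D Λ-sub F-stable Λ^∨⊆Λ
  , 1+D-trivial-on-image-quotient D Λ^∨-sub
      (isometry-preserves-dual B (idMat +M D) L B-sym F-isometry F-stable Λ^∨⊆Λ) Λ^∨⊆Λ
  where
  Λ-sub : IsAdditiveSubgroup (latticeOf L)
  Λ-sub = latticeOf-isAdditiveSubgroup L
  Λ^∨-sub : IsAdditiveSubgroup (dual B (latticeOf L))
  Λ^∨-sub = dual-isAdditiveSubgroup B (latticeOf L)
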